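{- Let $\theta\in\mathbb{F}_{q^3}^*$ and let $T\mathcal S_\theta=\{TX: X\in\mathcal S_\theta\}$. If $N(\theta)=1$ then every line of $T\mathcal S_\theta$ has Type II; otherwise every line of $T\mathcal S_\theta$ has Type III.
   Context: Let $q$ be a prime power, $\mathbb{F}_{q^3}^*=\mathbb{F}_{q^3}\setminus\{0\}$, $N(x)=x^{q^2+q+1}$. Points of $\mathrm{PG}(2,q^3)$ have coordinates $(x,y,z)$, lines $[a,b,c]$, incidence iff $ax+by+cz=0$. Let $\phi$ be the collineation $(x,y,z)\mapsto(z^q,x^q,y^q)$, acting on lines by $[d,e,f]\mapsto[f^q,d^q,e^q]$. A line has Type I, II or III according as its $\phi$-orbit is one line, three concurrent lines, or three non-concurrent lines. Let $T=(0,0,1)$ and for $\theta\in\mathbb{F}_{q^3}^*$ let $\mathcal S_\theta=\{(x\theta,x^q,0):x\in\mathbb{F}_{q^3}^*\}$. -}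

module Defs where

open import Level using (Level; _⊔_) renaming (suc to lsuc)
open import Data.Nat using (ℕ; zero; suc; _^_)
import Data.Nat as ℕ
open import Data.Fin using (Fin)
open import Data.Product using (Σ; ∃; _×_; _,_)
open import Relation.Nullary using (¬_)
open import Algebra.Bundles using (CommutativeRing)
open import Function.Bundles using (Bijection)
import Relation.Binary.PropositionalEquality as ≡

record FiniteField (c ℓ : Level) (n : ℕ) : Set (lsuc (c ⊔ ℓ)) where
  field
    commRing : CommutativeRing c ℓ
  open CommutativeRing commRing public
  field
    1≉0     : ¬ (1# ≈ 0#)
    inverse : ∀ x → ¬ (x ≈ 0#) → ∃ λ y → x * y ≈ 1#
    card    : Bijection setoid (≡.setoid (Fin n))

module PG {c ℓ : Level} {n : ℕ} (F : FiniteField c ℓ n) (q : ℕ) where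
  open FiniteField F

  pow : Carrier → ℕ → Carrier
  pow x zero    = 1#
  pow x (suc m) = x * pow x m

  N : Carrier → Carrier
  N x = pow x (q ^ 2 ℕ.+ q ℕ.+ 1)

  -- homogeneous coordinate triples (used both for points and lines)
  record Triple : Set c where
    constructor ⟨_,_,_⟩
    field
      t₁ t₂ t₃ : Carrier
  open Triple public

  NonZero : Triple → Set ℓ
  NonZero v = ¬ ((t₁ v ≈ 0#) × (t₂ v ≈ 0#) × (t₃ v ≈ 0#))

  Same : Triple → Triple → Set (c ⊔ ℓ)
  Same u v = Σ Carrier λ λ' → ¬ (λ' ≈ 0#) ×
               ((t₁ v ≈ λ' * t₁ u) × (t₂ v ≈ λ' * t₂ u) × (t₃ v ≈ λ' * t₃ u))

  Incident : Triple → Triple → Set ℓ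
  Incident P L = (t₁ L * t₁ P + t₂ L * t₂ P + t₃ L * t₃ P) ≈ 0#

  φL : Triple → Triple
  φL L = ⟨ pow (t₃ L) q , pow (t₁ L) q , pow (t₂ L) q ⟩

  ThreeDistinct : Triple → Set (c ⊔ ℓ)
  ThreeDistinct L = ¬ Same L (φL L) × ¬ Same (φL L) (φL (φL L)) × ¬ Same L (φL (φL L))

  Concurrent : Triple → Set (c ⊔ ℓ)
  Concurrent L = Σ Triple λ P → NonZero P ×
                   (Incident P L × Incident P (φL L) × Incident P (φL (φL L)))

  TypeI : Triple → Set (c ⊔ ℓ)
  TypeI L = Same L (φL L)

  TypeII : Triple → Set (c ⊔ ℓ)
  TypeII L = ThreeDistinct L × Concurrent L

  TypeIII : Triple → Set (c ⊔ ℓ)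
  TypeIII L = ThreeDistinct L × ¬ Concurrent L

  T : Triple
  T = ⟨ 0# , 0# , 1# ⟩

  Sθ : Carrier → Carrier → Triple
  Sθ θ x = ⟨ x * θ , pow x q , 0# ⟩

  -- L is (a coordinate triple of) the line TX for some X ∈ S_θ
  LineOfTS : Carrier → Triple → Set (c ⊔ ℓ)
  LineOfTS θ L = NonZero L × Σ Carrier λ x → ¬ (x ≈ 0#) ×
                   (Incident T L × Incident (Sθ θ x) L)

{-# OPTIONS --safe #-}
module Submission where

-- A line through T = (0,0,1) is [d, e, 0], and it passes through (xθ, x^q, 0) iff
-- d x θ + e x^q = 0, which forces d ≠ 0.  Its φ-orbit [d, e, 0], [0, d^q, e^q],
-- [e^(q²), 0, d^(q²)] consists of three distinct lines with determinant N(d) + N(e), so they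
-- are concurrent iff N(d) + N(e) = 0.  Taking norms in e x^q = −d x θ, using N(x^q) = N(x)
-- (as x^(q³) = x) and N(−1) = −1, gives N(e) = −N(d) N(θ); hence N(d) + N(e) = N(d)(1 − N(θ))
-- vanishes iff N(θ) = 1.

open import Level using (Level)
open import Data.Fin using (Fin; punchIn)
import Data.Fin as Fin
open import Data.Fin.Properties using (punchInᵢ≢i)
open import Data.Fin.Permutation
  using (Permutation; permutation; remove; insert; _⟨$⟩ʳ_; insert-punchIn; insert-remove)
open import Data.Nat using (ℕ; zero; suc; NonZero; _^_)
import Data.Nat as ℕ
open import Data.Nat.Primality using (Prime; prime⇒nonZero)
open import Data.Nat.Properties using (m^n≢0)
import Data.Nat.Properties as ℕₚ
open import Data.Nat.Tactic.RingSolver using (solve-∀)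
open import Data.Product using (_×_; _,_; proj₁; proj₂)
open import Data.Sum using (_⊎_; inj₁; inj₂)
open import Function using (_∘_)
open import Function.Bundles using (Bijection; Inverse; Equivalence; _⇔_; mk⇔)
open import Function.Properties.Bijection using (Bijection⇒Inverse)
open import Relation.Binary.PropositionalEquality as ≡ using (_≡_)
open import Relation.Nullary using (¬_)

open import Defs

module FieldProperties {c ℓ n} (F : FiniteField c ℓ n) where
  open FiniteField F
  open import Relation.Binary.Reasoning.Setoid setoid
  open import Algebra.Properties.Ring ring using (-‿distribʳ-*; +-cancelʳ)
  open import Algebra.Solver.Ring.NaturalCoefficients.Default commutativeSemiring
  import Algebra.Properties.CommutativeMonoid.Sum *-commutativeMonoid as Product

  x*y≈0⇒y≈0 : ∀ {x y} → x ≉ 0# → x * y ≈ 0# → y ≈ 0#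
  x*y≈0⇒y≈0 {x} {y} x≉0 xy≈0 with inverse x x≉0
  ... | x⁻¹ , xx⁻¹≈1 = begin
    y              ≈⟨ *-identityˡ y ⟨
    1# * y         ≈⟨ *-congʳ (trans (*-comm x⁻¹ x) xx⁻¹≈1) ⟨
    (x⁻¹ * x) * y  ≈⟨ *-assoc x⁻¹ x y ⟩
    x⁻¹ * (x * y)  ≈⟨ *-congˡ xy≈0 ⟩
    x⁻¹ * 0#       ≈⟨ zeroʳ x⁻¹ ⟩
    0#             ∎

  x*y≉0 : ∀ {x y} → x ≉ 0# → y ≉ 0# → x * y ≉ 0#
  x*y≉0 x≉0 y≉0 xy≈0 = y≉0 (x*y≈0⇒y≈0 x≉0 xy≈0)

  *-cancelʳ : ∀ {x y z} → z ≉ 0# → x * z ≈ y * z → x ≈ y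
  *-cancelʳ {x} {y} {z} z≉0 xz≈yz with inverse z z≉0
  ... | z⁻¹ , zz⁻¹≈1 = begin
    x              ≈⟨ *-identityʳ x ⟨
    x * 1#         ≈⟨ *-congˡ zz⁻¹≈1 ⟨
    x * (z * z⁻¹)  ≈⟨ *-assoc x z z⁻¹ ⟨
    (x * z) * z⁻¹  ≈⟨ *-congʳ xz≈yz ⟩
    (y * z) * z⁻¹  ≈⟨ *-assoc y z z⁻¹ ⟩
    y * (z * z⁻¹)  ≈⟨ *-congˡ zz⁻¹≈1 ⟩
    y * 1#         ≈⟨ *-identityʳ y ⟩
    y              ∎

  ∏ : ∀ {k} → (Fin k → Carrier) → Carrier
  ∏ = Product.sum

  ∏≉0 : ∀ {k} (f : Fin k → Carrier) → (∀ i → f i ≉ 0#) → ∏ f ≉ 0#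
  ∏≉0 {zero}  f f≉0 = 1≉0
  ∏≉0 {suc k} f f≉0 = x*y≉0 (f≉0 Fin.zero) (∏≉0 (λ i → f (Fin.suc i)) (λ i → f≉0 (Fin.suc i)))

  x*-y+z≈0 : ∀ {x y z} → x * y ≈ z → x * - y + z ≈ 0#
  x*-y+z≈0 {x} {y} {z} xy≈z = begin
    x * - y + z     ≈⟨ +-congʳ (-‿distribʳ-* x y) ⟨
    - (x * y) + z   ≈⟨ +-congʳ (-‿cong xy≈z) ⟩
    - z + z         ≈⟨ -‿inverseˡ z ⟩
    0#              ∎

  zero-coeff₁ : ∀ {k x u v} → k ≈ 0# → k * x + u + v ≈ u + v
  zero-coeff₁ {k} {x} {u} k≈0 = +-congʳ (trans (+-congʳ (trans (*-congʳ k≈0) (zeroˡ x))) (+-identityˡ u))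

  zero-coeff₂ : ∀ {k x u v} → k ≈ 0# → u + k * x + v ≈ u + v
  zero-coeff₂ {k} {x} {u} k≈0 = +-congʳ (trans (+-congˡ (trans (*-congʳ k≈0) (zeroˡ x))) (+-identityʳ u))

  zero-coeff₃ : ∀ {k x u v} → k ≈ 0# → u + v + k * x ≈ u + v
  zero-coeff₃ {k} {x} {u} {v} k≈0 = trans (+-congˡ (trans (*-congʳ k≈0) (zeroˡ x))) (+-identityʳ (u + v))

  x*t+y≈0⇒[x+y≈0⇔t≈1] : ∀ {x t y} → x ≉ 0# → x * t + y ≈ 0# → (x + y ≈ 0# ⇔ t ≈ 1#)
  x*t+y≈0⇒[x+y≈0⇔t≈1] {x} {t} {y} x≉0 xt+y≈0 = mk⇔ x+y≈0⇒t≈1 t≈1⇒x+y≈0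
    where
    t≈1⇒x+y≈0 : t ≈ 1# → x + y ≈ 0#
    t≈1⇒x+y≈0 t≈1 = trans (+-congʳ (trans (sym (*-identityʳ x)) (*-congˡ (sym t≈1)))) xt+y≈0
    x+y≈0⇒t≈1 : x + y ≈ 0# → t ≈ 1#
    x+y≈0⇒t≈1 x+y≈0 = *-cancelʳ x≉0 (begin
      t * x    ≈⟨ *-comm t x ⟩
      x * t    ≈⟨ +-cancelʳ y (x * t) x (trans xt+y≈0 (sym x+y≈0)) ⟩
      x        ≈⟨ *-identityˡ x ⟨
      1# * x   ∎)

  cyclic-system-trivial : ∀ {a b a′ b′ a″ b″ X Y Z} → a * a′ * a″ + b * b′ * b″ ≉ 0# →
                          a * X + b * Y ≈ 0# → a′ * Y + b′ * Z ≈ 0# → b″ * X + a″ * Z ≈ 0# →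
                          X ≈ 0# × Y ≈ 0# × Z ≈ 0#
  cyclic-system-trivial {a} {b} {a′} {b′} {a″} {b″} {X} {Y} {Z} D≉0 E₁≈0 E₂≈0 E₃≈0 =
      x*y≈0⇒y≈0 D≉0 (vanishes E₂≈0 E₁≈0 E₃≈0 adjugate₁)
    , x*y≈0⇒y≈0 D≉0 (vanishes E₃≈0 E₁≈0 E₂≈0 adjugate₂)
    , x*y≈0⇒y≈0 D≉0 (vanishes E₁≈0 E₂≈0 E₃≈0 adjugate₃)
    where
    D : Carrier
    D = a * a′ * a″ + b * b′ * b″

    -- The rows of the adjugate matrix, with the negative entries moved to the other side:
    -- the solver used here only knows commutative semirings.
    adjugate₁ : D * X + a″ * b * (a′ * Y + b′ * Z) ≈ a′ * a″ * (a * X + b * Y) + b * b′ * (b″ * X + a″ * Z)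
    adjugate₁ = solve 9 (λ a b a′ b′ a″ b″ X Y Z →
      (a :* a′ :* a″ :+ b :* b′ :* b″) :* X :+ a″ :* b :* (a′ :* Y :+ b′ :* Z)
        := a′ :* a″ :* (a :* X :+ b :* Y) :+ b :* b′ :* (b″ :* X :+ a″ :* Z)) refl a b a′ b′ a″ b″ X Y Z

    adjugate₂ : D * Y + a * b′ * (b″ * X + a″ * Z) ≈ b′ * b″ * (a * X + b * Y) + a * a″ * (a′ * Y + b′ * Z)
    adjugate₂ = solve 9 (λ a b a′ b′ a″ b″ X Y Z →
      (a :* a′ :* a″ :+ b :* b′ :* b″) :* Y :+ a :* b′ :* (b″ :* X :+ a″ :* Z)
        := b′ :* b″ :* (a :* X :+ b :* Y) :+ a :* a″ :* (a′ :* Y :+ b′ :* Z)) refl a b a′ b′ a″ b″ X Y Z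

    adjugate₃ : D * Z + a′ * b″ * (a * X + b * Y) ≈ b * b″ * (a′ * Y + b′ * Z) + a * a′ * (b″ * X + a″ * Z)
    adjugate₃ = solve 9 (λ a b a′ b′ a″ b″ X Y Z →
      (a :* a′ :* a″ :+ b :* b′ :* b″) :* Z :+ a′ :* b″ :* (a :* X :+ b :* Y)
        := b :* b″ :* (a′ :* Y :+ b′ :* Z) :+ a :* a′ :* (b″ :* X :+ a″ :* Z)) refl a b a′ b′ a″ b″ X Y Z

    vanishes : ∀ {w k₁ E₁ k₂ E₂ k₃ E₃} → E₁ ≈ 0# → E₂ ≈ 0# → E₃ ≈ 0# →
               w + k₁ * E₁ ≈ k₂ * E₂ + k₃ * E₃ → w ≈ 0#
    vanishes {w} {k₁} {E₁} {k₂} {E₂} {k₃} {E₃} E₁≈0 E₂≈0 E₃≈0 eq = begin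
      w                      ≈⟨ +-identityʳ w ⟨
      w + 0#                 ≈⟨ +-congˡ (trans (*-congˡ E₁≈0) (zeroʳ k₁)) ⟨
      w + k₁ * E₁            ≈⟨ eq ⟩
      k₂ * E₂ + k₃ * E₃      ≈⟨ +-cong (trans (*-congˡ E₂≈0) (zeroʳ k₂)) (trans (*-congˡ E₃≈0) (zeroʳ k₃)) ⟩
      0# + 0#                ≈⟨ +-identityʳ 0# ⟩
      0#                     ∎

module PowerProperties {c ℓ n} (F : FiniteField c ℓ n) (q : ℕ) where
  open FiniteField F
  open PG F q using (pow; N)
  open FieldProperties F
  open import Relation.Binary.Reasoning.Setoid setoid
  open import Algebra.Properties.Ring ring using (-1*x≈-x; -‿involutive)
  open import Algebra.Properties.Semiring.Exp semiring using (^-congˡ; ^-homo-*; ^-assocʳ) renaming (_^_ to _^ᴿ_)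
  open import Algebra.Properties.CommutativeSemiring.Exp commutativeSemiring using (^-distrib-*)
  import Algebra.Properties.CommutativeMonoid.Sum *-commutativeMonoid as Product

  pow≡^ : ∀ x m → pow x m ≡ x ^ᴿ m
  pow≡^ x zero    = ≡.refl
  pow≡^ x (suc m) = ≡.cong (x *_) (pow≡^ x m)

  pow-congˡ : ∀ {x y} m → x ≈ y → pow x m ≈ pow y m
  pow-congˡ {x} {y} m x≈y rewrite pow≡^ x m | pow≡^ y m = ^-congˡ m x≈y

  pow-homo-* : ∀ x m k → pow x (m ℕ.+ k) ≈ pow x m * pow x k
  pow-homo-* x m k rewrite pow≡^ x (m ℕ.+ k) | pow≡^ x m | pow≡^ x k = ^-homo-* x m k

  pow-assocʳ : ∀ x m k → pow (pow x m) k ≈ pow x (m ℕ.* k)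
  pow-assocʳ x m k rewrite pow≡^ (pow x m) k | pow≡^ x m | pow≡^ x (m ℕ.* k) = ^-assocʳ x m k

  pow-distrib-* : ∀ x y m → pow (x * y) m ≈ pow x m * pow y m
  pow-distrib-* x y m rewrite pow≡^ (x * y) m | pow≡^ x m | pow≡^ y m = ^-distrib-* x y m

  pow≉0 : ∀ {x} m → x ≉ 0# → pow x m ≉ 0#
  pow≉0 zero    x≉0 = 1≉0
  pow≉0 (suc m) x≉0 = x*y≉0 x≉0 (pow≉0 m x≉0)

  pow-zero : ∀ m .{{_ : NonZero m}} → pow 0# m ≈ 0#
  pow-zero (suc m) = zeroˡ (pow 0# m)

  ∏-scale : ∀ {k} x (f : Fin k → Carrier) → ∏ (λ i → x * f i) ≈ pow x k * ∏ f
  ∏-scale {k} x f = begin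
    ∏ (λ i → x * f i)      ≈⟨ Product.∑-distrib-+ (λ _ → x) f ⟩
    ∏ {k} (λ _ → x) * ∏ f  ≈⟨ *-congʳ (Product.sum-replicate k {x}) ⟩
    x ^ᴿ k * ∏ f           ≡⟨ ≡.cong (_* ∏ f) (pow≡^ x k) ⟨
    pow x k * ∏ f          ∎

  pow-1# : ∀ k → pow 1# k ≈ 1#
  pow-1# zero    = refl
  pow-1# (suc k) = trans (*-identityˡ (pow 1# k)) (pow-1# k)

  -1*-1≈1 : - 1# * - 1# ≈ 1#
  -1*-1≈1 = trans (-1*x≈-x (- 1#)) (-‿involutive 1#)

  pow-‿1 : ∀ k → pow (- 1#) k ≈ 1# ⊎ pow (- 1#) k ≈ - 1#
  pow-‿1 zero = inj₁ refl
  pow-‿1 (suc k) with pow-‿1 k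
  ... | inj₁ s≈1  = inj₂ (trans (*-congˡ s≈1) (*-identityʳ (- 1#)))
  ... | inj₂ s≈-1 = inj₁ (trans (*-congˡ s≈-1) -1*-1≈1)

  N-expand : ∀ x → N x ≈ x * pow x q * pow (pow x q) q
  N-expand x = begin
    pow x (q ^ 2 ℕ.+ q ℕ.+ 1)         ≡⟨ ≡.cong (pow x) (exponent q) ⟩
    x * pow x (q ℕ.+ q ℕ.* q)         ≈⟨ *-congˡ (pow-homo-* x q (q ℕ.* q)) ⟩
    x * (pow x q * pow x (q ℕ.* q))   ≈⟨ *-congˡ (*-congˡ (pow-assocʳ x q q)) ⟨
    x * (pow x q * pow (pow x q) q)   ≈⟨ *-assoc x (pow x q) (pow (pow x q) q) ⟨
    x * pow x q * pow (pow x q) q     ∎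
    where
    exponent : ∀ q → q ℕ.* (q ℕ.* 1) ℕ.+ q ℕ.+ 1 ≡ suc (q ℕ.+ q ℕ.* q)
    exponent = solve-∀

  N-homo-* : ∀ x y → N (x * y) ≈ N x * N y
  N-homo-* x y = pow-distrib-* x y (q ^ 2 ℕ.+ q ℕ.+ 1)

  N≉0 : ∀ {x} → x ≉ 0# → N x ≉ 0#
  N≉0 = pow≉0 (q ^ 2 ℕ.+ q ℕ.+ 1)

  N-‿1 : N (- 1#) ≈ - 1#
  N-‿1 with pow-‿1 q
  ... | inj₁ s≈1 = begin
    N (- 1#)                                         ≈⟨ N-expand (- 1#) ⟩
    - 1# * pow (- 1#) q * pow (pow (- 1#) q) q       ≈⟨ *-cong (*-congˡ s≈1) (trans (pow-congˡ q s≈1) (pow-1# q)) ⟩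
    - 1# * 1# * 1#                                   ≈⟨ trans (*-identityʳ _) (*-identityʳ _) ⟩
    - 1#                                             ∎
  ... | inj₂ s≈-1 = begin
    N (- 1#)                                         ≈⟨ N-expand (- 1#) ⟩
    - 1# * pow (- 1#) q * pow (pow (- 1#) q) q       ≈⟨ *-cong (*-congˡ s≈-1) (trans (pow-congˡ q s≈-1) s≈-1) ⟩
    - 1# * - 1# * - 1#                               ≈⟨ *-congʳ -1*-1≈1 ⟩
    1# * - 1#                                        ≈⟨ *-identityˡ (- 1#) ⟩
    - 1#                                             ∎

  N-‿ : ∀ x → N (- x) ≈ - N x
  N-‿ x = begin
    N (- x)           ≈⟨ pow-congˡ (q ^ 2 ℕ.+ q ℕ.+ 1) (-1*x≈-x x) ⟨
    N (- 1# * x)      ≈⟨ N-homo-* (- 1#) x ⟩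
    N (- 1#) * N x    ≈⟨ *-congʳ N-‿1 ⟩
    - 1# * N x        ≈⟨ -1*x≈-x (N x) ⟩
    - N x             ∎

permutation-fixing-punchIn : ∀ {k} (π : Permutation (suc k) (suc k)) {i} → π ⟨$⟩ʳ i ≡ i →
                             ∀ j → π ⟨$⟩ʳ punchIn i j ≡ punchIn i (remove i π ⟨$⟩ʳ j)
permutation-fixing-punchIn π {i} πi≡i j = begin
  π ⟨$⟩ʳ punchIn i j                                   ≡⟨ insert-remove i π (punchIn i j) ⟨
  insert i (π ⟨$⟩ʳ i) (remove i π) ⟨$⟩ʳ punchIn i j   ≡⟨ insert-punchIn i (π ⟨$⟩ʳ i) (remove i π) j ⟩
  punchIn (π ⟨$⟩ʳ i) (remove i π ⟨$⟩ʳ j)              ≡⟨ ≡.cong (λ i′ → punchIn i′ (remove i π ⟨$⟩ʳ j)) πi≡i ⟩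
  punchIn i (remove i π ⟨$⟩ʳ j)                       ∎
  where open ≡.≡-Reasoning

module UnitGroup {c ℓ m} (F : FiniteField c ℓ (suc m)) (q : ℕ) where
  open FiniteField F
  open PG F q using (pow)
  open FieldProperties F
  open PowerProperties F q
  open Inverse (Bijection⇒Inverse card) using (to; from; to-cong; strictlyInverseˡ; strictlyInverseʳ)
  open import Relation.Binary.Reasoning.Setoid setoid
  import Algebra.Properties.CommutativeMonoid.Sum *-commutativeMonoid as Product

  i₀ : Fin (suc m)
  i₀ = to 0#

  -- The nonzero elements, indexed by punching the index of 0 out of Fin (suc m); multiplication
  -- by a nonzero x permutes them, which is why x ^ m ≈ 1.
  unit : Fin m → Carrier
  unit j = from (punchIn i₀ j)

  unit≉0 : ∀ j → unit j ≉ 0#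
  unit≉0 j unit≈0 =
    punchInᵢ≢i i₀ j (≡.trans (≡.sym (strictlyInverseˡ (punchIn i₀ j))) (to-cong unit≈0))

  multiplyBy : Carrier → Fin (suc m) → Fin (suc m)
  multiplyBy y i = to (y * from i)

  multiplyBy-inverse : ∀ {y z} → y * z ≈ 1# → ∀ i → multiplyBy y (multiplyBy z i) ≡ i
  multiplyBy-inverse {y} {z} yz≈1 i = ≡.trans (to-cong y*z*from-i≈from-i) (strictlyInverseˡ i)
    where
    y*z*from-i≈from-i : y * from (to (z * from i)) ≈ from i
    y*z*from-i≈from-i = begin
      y * from (to (z * from i))  ≈⟨ *-congˡ (strictlyInverseʳ (z * from i)) ⟩
      y * (z * from i)            ≈⟨ *-assoc y z (from i) ⟨
      (y * z) * from i            ≈⟨ *-congʳ yz≈1 ⟩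
      1# * from i                 ≈⟨ *-identityˡ (from i) ⟩
      from i                      ∎

  module _ {x : Carrier} (x≉0 : x ≉ 0#) where
    private
      x⁻¹ : Carrier
      x⁻¹ = proj₁ (inverse x x≉0)

      x*x⁻¹≈1 : x * x⁻¹ ≈ 1#
      x*x⁻¹≈1 = proj₂ (inverse x x≉0)

    scaling : Permutation (suc m) (suc m)
    scaling = permutation (multiplyBy x) (multiplyBy x⁻¹)
      (multiplyBy-inverse x*x⁻¹≈1) (multiplyBy-inverse (trans (*-comm x⁻¹ x) x*x⁻¹≈1))

    scaling-fixes-i₀ : scaling ⟨$⟩ʳ i₀ ≡ i₀
    scaling-fixes-i₀ = to-cong (trans (*-congˡ (strictlyInverseʳ 0#)) (zeroʳ x))

    unit-scaling : ∀ j → x * unit j ≈ unit (remove i₀ scaling ⟨$⟩ʳ j)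
    unit-scaling j = begin
      x * unit j                                  ≈⟨ strictlyInverseʳ (x * unit j) ⟨
      from (scaling ⟨$⟩ʳ punchIn i₀ j)            ≡⟨ ≡.cong from (permutation-fixing-punchIn scaling scaling-fixes-i₀ j) ⟩
      unit (remove i₀ scaling ⟨$⟩ʳ j)             ∎

    pow-pred-card : pow x m ≈ 1#
    pow-pred-card = *-cancelʳ (∏≉0 unit unit≉0) (begin
      pow x m * ∏ unit                          ≈⟨ ∏-scale x unit ⟨
      ∏ (λ j → x * unit j)                      ≈⟨ Product.sum-cong-≋ unit-scaling ⟩
      ∏ (λ j → unit (remove i₀ scaling ⟨$⟩ʳ j)) ≈⟨ Product.sum-permute unit (remove i₀ scaling) ⟨
      ∏ unit                                    ≈⟨ *-identityˡ (∏ unit) ⟨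
      1# * ∏ unit                               ∎)

pow-card : ∀ {c ℓ n} (F : FiniteField c ℓ n) (q : ℕ) →
           let open FiniteField F in ∀ {x} → x ≉ 0# → PG.pow F q x n ≈ x
pow-card {n = zero}  F q x≉0 with () ← Bijection.to (FiniteField.card F) (FiniteField.0# F)
pow-card {n = suc m} F q {x} x≉0 = trans (*-congˡ (pow-pred-card x≉0)) (*-identityʳ x)
  where open FiniteField F
        open UnitGroup F q

module Orbit {c ℓ n} (F : FiniteField c ℓ n) (q : ℕ) .{{_ : NonZero q}} where
  open FiniteField F
  open PG F q
  open FieldProperties F
  open PowerProperties F q
  open import Relation.Binary.Reasoning.Setoid setoid
  open import Algebra.Properties.CommutativeSemigroup *-commutativeSemigroup using (x∙yz≈y∙xz)
  open import Algebra.Solver.Ring.NaturalCoefficients.Default commutativeSemiring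

  module _ {d e f : Carrier} (f≈0 : f ≈ 0#) where
    private
      f^q≈0 : pow f q ≈ 0#
      f^q≈0 = trans (pow-congˡ q f≈0) (pow-zero q)

      f^qq≈0 : pow (pow f q) q ≈ 0#
      f^qq≈0 = trans (pow-congˡ q f^q≈0) (pow-zero q)

    orbit-threeDistinct : d ≉ 0# → ThreeDistinct ⟨ d , e , f ⟩
    orbit-threeDistinct d≉0 =
        (λ { (k , k≉0 , f^q≈kd , _) → x*y≉0 k≉0 d≉0 (trans (sym f^q≈kd) f^q≈0) })
      , (λ { (k , k≉0 , _ , f^qq≈kd^q , _) → x*y≉0 k≉0 (pow≉0 q d≉0) (trans (sym f^qq≈kd^q) f^qq≈0) })
      , (λ { (k , _ , _ , _ , d^qq≈kf) →
               pow≉0 q (pow≉0 q d≉0) (trans d^qq≈kf (trans (*-congˡ f≈0) (zeroʳ k))) })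

    orbit-concurrent : d ≉ 0# → N d + N e ≈ 0# → Concurrent ⟨ d , e , f ⟩
    -- The witness is the cross product of the first two lines of the orbit.
    orbit-concurrent d≉0 Nd+Ne≈0 =
      ⟨ e * eq , - (d * eq) , d * dq ⟩ , (λ (_ , _ , ddq≈0) → x*y≉0 d≉0 (pow≉0 q d≉0) ddq≈0)
        , on-L , on-φL , on-φ²L
      where
      dq eq dqq eqq : Carrier
      dq  = pow d q
      eq  = pow e q
      dqq = pow dq q
      eqq = pow eq q
      on-L : d * (e * eq) + e * - (d * eq) + f * (d * dq) ≈ 0#
      on-L = trans (zero-coeff₃ f≈0) (trans (+-comm _ _) (x*-y+z≈0 (x∙yz≈y∙xz e d eq)))
      on-φL : pow f q * (e * eq) + dq * - (d * eq) + eq * (d * dq) ≈ 0#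
      on-φL = trans (zero-coeff₁ f^q≈0)
        (x*-y+z≈0 (solve 3 (λ d dq eq → dq :* (d :* eq) := eq :* (d :* dq)) refl d dq eq))
      on-φ²L : eqq * (e * eq) + pow (pow f q) q * - (d * eq) + dqq * (d * dq) ≈ 0#
      on-φ²L = begin
        eqq * (e * eq) + pow (pow f q) q * - (d * eq) + dqq * (d * dq)  ≈⟨ zero-coeff₂ f^qq≈0 ⟩
        eqq * (e * eq) + dqq * (d * dq)                                 ≈⟨ +-cong (*-comm eqq _) (*-comm dqq _) ⟩
        e * eq * eqq + d * dq * dqq                                     ≈⟨ +-cong (N-expand e) (N-expand d) ⟨
        N e + N d                                                       ≈⟨ +-comm (N e) (N d) ⟩
        N d + N e                                                       ≈⟨ Nd+Ne≈0 ⟩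
        0#                                                              ∎

    orbit-¬concurrent : N d + N e ≉ 0# → ¬ Concurrent ⟨ d , e , f ⟩
    orbit-¬concurrent Nd+Ne≉0 (⟨ X , Y , Z ⟩ , P≢0 , on-L , on-φL , on-φ²L) =
      P≢0 (cyclic-system-trivial
             (Nd+Ne≉0 ∘ trans (+-cong (N-expand d) (N-expand e)))
             (trans (sym (zero-coeff₃ f≈0)) on-L)
             (trans (sym (zero-coeff₁ f^q≈0)) on-φL)
             (trans (sym (zero-coeff₂ f^qq≈0)) on-φ²L))

    orbit-typeII : d ≉ 0# → N d + N e ≈ 0# → TypeII ⟨ d , e , f ⟩
    orbit-typeII d≉0 Nd+Ne≈0 = orbit-threeDistinct d≉0 , orbit-concurrent d≉0 Nd+Ne≈0

    orbit-typeIII : d ≉ 0# → N d + N e ≉ 0# → TypeIII ⟨ d , e , f ⟩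
    orbit-typeIII d≉0 Nd+Ne≉0 = orbit-threeDistinct d≉0 , orbit-¬concurrent Nd+Ne≉0

module LinesOfTS {c ℓ} (q : ℕ) (F : FiniteField c ℓ (q ^ 3)) where
  open FiniteField F
  open PG F q
  open FieldProperties F
  open PowerProperties F q
  open import Relation.Binary.Reasoning.Setoid setoid
  open import Algebra.Properties.Ring ring using (+-inverseʳ-unique)
  open import Algebra.Solver.Ring.NaturalCoefficients.Default commutativeSemiring

  N-frobenius : ∀ {x} → x ≉ 0# → N (pow x q) ≈ N x
  N-frobenius {x} x≉0 = begin
    N (pow x q)                                           ≈⟨ N-expand (pow x q) ⟩
    pow x q * pow (pow x q) q * pow (pow (pow x q) q) q   ≈⟨ *-congˡ x^qqq≈x ⟩
    pow x q * pow (pow x q) q * x                         ≈⟨ trans (*-comm _ x) (sym (*-assoc x _ _)) ⟩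
    x * pow x q * pow (pow x q) q                         ≈⟨ N-expand x ⟨
    N x                                                   ∎
    where
    x^qqq≈x : pow (pow (pow x q) q) q ≈ x
    x^qqq≈x = begin
      pow (pow (pow x q) q) q   ≈⟨ pow-assocʳ (pow x q) q q ⟩
      pow (pow x q) (q ℕ.* q)   ≈⟨ pow-assocʳ x q (q ℕ.* q) ⟩
      pow x (q ℕ.* (q ℕ.* q))   ≡⟨ ≡.cong (λ k → pow x (q ℕ.* (q ℕ.* k))) (ℕₚ.*-identityʳ q) ⟨
      pow x (q ^ 3)             ≈⟨ pow-card F q x≉0 ⟩
      x                         ∎

  norm-relation : ∀ {θ x d e} → x ≉ 0# → d * (x * θ) + e * pow x q ≈ 0# → N d * N θ + N e ≈ 0#
  norm-relation {θ} {x} {d} {e} x≉0 incidence = x*y≈0⇒y≈0 (N≉0 x≉0) (begin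
    N x * (N d * N θ + N e)
      ≈⟨ solve 4 (λ Nx Nd Nθ Ne → Nx :* (Nd :* Nθ :+ Ne) := Nd :* (Nx :* Nθ) :+ Ne :* Nx)
                 refl (N x) (N d) (N θ) (N e) ⟩
    N d * (N x * N θ) + N e * N x                ≈⟨ +-congˡ Ne*Nx≈-Nd*Nx*Nθ ⟩
    N d * (N x * N θ) + - (N d * (N x * N θ))    ≈⟨ -‿inverseʳ _ ⟩
    0#                                           ∎)
    where
    Ne*Nx≈-Nd*Nx*Nθ : N e * N x ≈ - (N d * (N x * N θ))
    Ne*Nx≈-Nd*Nx*Nθ = begin
      N e * N x                ≈⟨ *-congˡ (N-frobenius x≉0) ⟨
      N e * N (pow x q)        ≈⟨ N-homo-* e (pow x q) ⟨
      N (e * pow x q)          ≈⟨ pow-congˡ (q ^ 2 ℕ.+ q ℕ.+ 1) (+-inverseʳ-unique _ _ incidence) ⟩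
      N (- (d * (x * θ)))      ≈⟨ N-‿ (d * (x * θ)) ⟩
      - N (d * (x * θ))        ≈⟨ -‿cong (trans (N-homo-* d (x * θ)) (*-congˡ (N-homo-* x θ))) ⟩
      - (N d * (N x * N θ))    ∎

  module _ {θ : Carrier} {L : Triple} where
    lineOfTS-t₃≈0 : LineOfTS θ L → t₃ L ≈ 0#
    lineOfTS-t₃≈0 (_ , _ , _ , T∈L , _) = begin
      t₃ L
        ≈⟨ solve 3 (λ d e f → f := d :* con 0 :+ e :* con 0 :+ f :* con 1) refl (t₁ L) (t₂ L) (t₃ L) ⟩
      t₁ L * 0# + t₂ L * 0# + t₃ L * 1#  ≈⟨ T∈L ⟩
      0#                                 ∎

    incident-Sθ : ∀ x → Incident (Sθ θ x) L → t₁ L * (x * θ) + t₂ L * pow x q ≈ 0#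
    incident-Sθ x Sx∈L = trans (sym (trans (+-congˡ (zeroʳ (t₃ L))) (+-identityʳ _))) Sx∈L

    lineOfTS-t₁≉0 : LineOfTS θ L → t₁ L ≉ 0#
    lineOfTS-t₁≉0 L∈TS@(L≢0 , x , x≉0 , _ , Sx∈L) d≈0 = L≢0 (d≈0 , e≈0 , lineOfTS-t₃≈0 L∈TS)
      where
      e≈0 : t₂ L ≈ 0#
      e≈0 = x*y≈0⇒y≈0 (pow≉0 q x≉0) (begin
        pow x q * t₂ L                          ≈⟨ *-comm _ _ ⟩
        t₂ L * pow x q                          ≈⟨ +-identityˡ _ ⟨
        0# + t₂ L * pow x q                     ≈⟨ +-congʳ (trans (*-congʳ d≈0) (zeroˡ (x * θ))) ⟨
        t₁ L * (x * θ) + t₂ L * pow x q         ≈⟨ incident-Sθ x Sx∈L ⟩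
        0#                                      ∎)

    lineOfTS-concurrency-criterion : LineOfTS θ L → (N (t₁ L) + N (t₂ L) ≈ 0# ⇔ N θ ≈ 1#)
    lineOfTS-concurrency-criterion L∈TS@(_ , x , x≉0 , _ , Sx∈L) =
      x*t+y≈0⇒[x+y≈0⇔t≈1] (N≉0 (lineOfTS-t₁≉0 L∈TS)) (norm-relation x≉0 (incident-Sθ x Sx∈L))

lemma2p3 : {c ℓ : Level} (p k q : ℕ) → Prime p → q ≡ p ^ suc k →
    (F : FiniteField c ℓ (q ^ 3)) → (θ : FiniteField.Carrier F) →
    ¬ (FiniteField._≈_ F θ (FiniteField.0# F)) →
    ((FiniteField._≈_ F (PG.N F q θ) (FiniteField.1# F)) →
       ∀ L → PG.LineOfTS F q θ L → PG.TypeII F q L) ×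
    (¬ (FiniteField._≈_ F (PG.N F q θ) (FiniteField.1# F)) →
       ∀ L → PG.LineOfTS F q θ L → PG.TypeIII F q L)
lemma2p3 p k q p-prime q≡p^k+1 F θ _ = typeII , typeIII
  where
  instance
    q≢0 : NonZero q
    q≢0 = ≡.subst NonZero (≡.sym q≡p^k+1) (m^n≢0 p (suc k) {{prime⇒nonZero p-prime}})
  open FiniteField F
  open PG F q
  open Orbit F q
  open LinesOfTS q F

  typeII : N θ ≈ 1# → ∀ L → LineOfTS θ L → TypeII L
  typeII Nθ≈1 L L∈TS = orbit-typeII (lineOfTS-t₃≈0 L∈TS) (lineOfTS-t₁≉0 L∈TS)
    (Equivalence.from (lineOfTS-concurrency-criterion L∈TS) Nθ≈1)

  typeIII : N θ ≉ 1# → ∀ L → LineOfTS θ L → TypeIII L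
  typeIII Nθ≉1 L L∈TS = orbit-typeIII (lineOfTS-t₃≈0 L∈TS) (lineOfTS-t₁≉0 L∈TS)
    (Nθ≉1 ∘ Equivalence.to (lineOfTS-concurrency-criterion L∈TS))
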